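{- For every permutation $\sigma$ we have $\operatorname{zeil}(\sigma)=\min\{\operatorname{rmax}(\sigma),\operatorname{tl}(s(\sigma))\}$.
   Context: Permutations are permutations of finite sets of positive integers, written in one-line notation; the normalization of a permutation of length $n$ replaces its $i$-th smallest entry by $i$. A permutation statistic is a function from permutations to nonnegative integers that takes equal values on permutations with the same normalization, so it suffices to define it on $S_n$. The stack-sorting map $s$ is defined recursively: $s$ of the empty permutation is empty, and if $\pi$ has largest entry $n$ and $\pi=LnR$, then $s(\pi)=s(L)s(R)n$. For $\pi\in S_n$: $\operatorname{rmax}(\pi)$ is the number of right-to-left maxima of $\pi$ (entries $\pi_i$ with $\pi_j<\pi_i$ for all $j>i$); $\operatorname{zeil}(\pi)$ is the largest $m$ such that $n,n-1,\ldots,n-m+1$ appear in decreasing order (left to right) in $\pi$; the tail length $\operatorname{tl}(\pi)$ is the smallest nonnegative integer $\ell$ with $\pi_{n-\ell}\neq n-\ell$, with the convention $\operatorname{tl}(12\cdots n)=n$. -}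

module Defs where

open import Data.Nat using (ℕ; zero; suc; _+_; _∸_; _⊔_; _<ᵇ_; _≡ᵇ_)
open import Data.Bool using (Bool; true; false; if_then_else_; _∧_)
open import Data.List using (List; []; _∷_; _++_; length; map; upTo; foldr; [_])
open import Data.List.Relation.Binary.Permutation.Propositional using (_↭_)
open import Data.Maybe using (Maybe; just; nothing)
open import Data.Product using (_×_; _,_)

IsPerm : ℕ → List ℕ → Set
IsPerm n σ = σ ↭ map suc (upTo n)

-- largest entry of a list (0 for the empty list; entries are positive)
maxL : List ℕ → ℕ
maxL = foldr _⊔_ 0

splitAt≡ : ℕ → List ℕ → List ℕ × List ℕ
splitAt≡ m [] = [] , []
splitAt≡ m (x ∷ xs) with x ≡ᵇ m
... | true  = [] , xs
... | false with splitAt≡ m xs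
...   | L , R = x ∷ L , R

-- stack-sorting map, s(LnR) = s(L) s(R) n, with fuel (length) for termination
stackSortF : ℕ → List ℕ → List ℕ
stackSortF zero    _  = []
stackSortF (suc k) [] = []
stackSortF (suc k) (x ∷ xs) with splitAt≡ (maxL (x ∷ xs)) (x ∷ xs)
... | L , R = stackSortF k L ++ stackSortF k R ++ [ maxL (x ∷ xs) ]

s : List ℕ → List ℕ
s σ = stackSortF (length σ) σ

allLess : ℕ → List ℕ → Bool
allLess x []       = true
allLess x (y ∷ ys) = (y <ᵇ x) ∧ allLess x ys

rmax : List ℕ → ℕ
rmax []       = 0
rmax (x ∷ xs) = (if allLess x xs then 1 else 0) + rmax xs

isSubseq : List ℕ → List ℕ → Bool
isSubseq []       _        = true
isSubseq (a ∷ as) []       = false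
isSubseq (a ∷ as) (b ∷ bs) = if a ≡ᵇ b then isSubseq as bs else isSubseq (a ∷ as) bs

topDown : ℕ → ℕ → List ℕ
topDown n m = map (λ i → n ∸ i) (upTo m)

-- zeil n σ = largest m ∈ {0,…,n} such that n, n-1, …, n-m+1 appear in
-- decreasing order (i.e. as a subsequence) in σ
zeil : ℕ → List ℕ → ℕ
zeil n σ = foldr (λ m acc → if isSubseq (topDown n m) σ then m ⊔ acc else acc) 0 (upTo (suc n))

-- 1-indexed entry lookup
entry : List ℕ → ℕ → Maybe ℕ
entry []       _             = nothing
entry (x ∷ xs) zero          = nothing
entry (x ∷ xs) (suc zero)    = just x
entry (x ∷ xs) (suc (suc i)) = entry xs (suc i)

isFixed : List ℕ → ℕ → Bool
isFixed π i with entry π i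
... | just v  = v ≡ᵇ i
... | nothing = false

-- tail length: smallest ℓ ∈ {0,…,n-1} with π_{n-ℓ} ≠ n-ℓ; n if there is none
tlFrom : ℕ → List ℕ → ℕ → ℕ → ℕ
tlFrom n π ℓ zero    = n
tlFrom n π ℓ (suc k) = if isFixed π (n ∸ ℓ) then tlFrom n π (suc ℓ) k else ℓ

tl : ℕ → List ℕ → ℕ
tl n π = tlFrom n π 0 n

-- Write D for the right-to-left maxima of σ, read from left to right. In a
-- permutation, n, n-1, …, n-m+1 occur in decreasing order exactly when they are
-- the first m entries of D (each then exceeds everything to its right), so zeil σ
-- is the length of the longest prefix of D of the form n, n-1, n-2, ….
-- Stack-sorting puts the maximum last, after the sorted part to its right, so
-- s σ ends with D reversed, while tl π is the length of the longest such prefix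
-- of reverse π. The two counts can only differ when the run exhausts D, and the
-- minimum with rmax σ = length D removes exactly that case.
module Submission where

open import Defs
open import Data.Nat using (ℕ; _⊓_)
open import Data.List using (List)
open import Relation.Binary.PropositionalEquality using (_≡_)

open import Data.Bool using (true; false; if_then_else_; T)
open import Data.Bool.Properties using (∧-zeroʳ)
open import Data.Empty using (⊥-elim)
open import Data.List using ([]; _∷_; _++_; _ʳ++_; [_]; length; map; foldr; reverse; upTo; applyUpTo)
open import Data.List.Properties
  using ( ++-assoc; length-map; length-upTo; length-reverse; length-++-sucʳ; length-++-≤ˡ; length-++-≤ʳ
        ; map-upTo; map-∘; map-cong; foldr-cong; reverse-++; reverse-involutive; ʳ++-defn )
open import Data.List.Membership.Propositional using (_∈_)
open import Data.List.Membership.Propositional.Properties using (∈-∃++; ∈-upTo⁺; ∈-upTo⁻)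
open import Data.List.Relation.Binary.Permutation.Propositional
  using (_↭_; prep; ↭-refl; ↭-sym; ↭-trans; ↭-reflexive; ↭⇒↭ₛ)
open import Data.List.Relation.Binary.Permutation.Propositional.Properties
  using (All-resp-↭; ↭-length; ++⁺; ++⁺ˡ; ∷↭∷ʳ)
open import Data.List.Relation.Binary.Sublist.Propositional using (_⊆_; []; _∷_; _∷ʳ_)
open import Data.List.Relation.Binary.Sublist.Propositional.Properties using (All-resp-⊆; length-mono-≤)
open import Data.List.Relation.Unary.All as All using (All; []; _∷_)
open import Data.List.Relation.Unary.All.Properties as AllP using (++⁻ˡ; ++⁻ʳ; ¬Any⇒All¬)
open import Data.List.Relation.Unary.AllPairs using (_∷_)
open import Data.List.Relation.Unary.Any using (Any; here; there)
open import Data.List.Relation.Unary.Any.Properties using (++⁺ʳ)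
open import Data.List.Relation.Unary.Unique.Propositional using (Unique)
import Data.List.Relation.Unary.Unique.Propositional.Properties as Unique
open import Data.Maybe using (just)
open import Data.Nat using (zero; suc; pred; _+_; _∸_; _⊔_; _≤_; _<_; _≡ᵇ_; _<ᵇ_; _≤ᵇ_; z≤n; s≤s; s≤s⁻¹)
open import Data.Nat.Properties
open import Data.List.Membership.DecPropositional _≟_ using (_∈?_)
open import Data.Product using (_×_; _,_; proj₁; proj₂; ∃)
open import Data.Sum using (inj₁; inj₂)
open import Function using (_∘_)
open import Relation.Binary.PropositionalEquality
  using (refl; sym; trans; cong; cong₂; subst; _≢_; ≢-sym; setoid; module ≡-Reasoning)
open import Data.List.Relation.Binary.Permutation.Setoid.Properties (setoid ℕ) using (Unique-resp-↭)
open import Relation.Nullary using (yes; no)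
open import Relation.Nullary.Decidable using (dec-true; dec-false)

open ≡-Reasoning

≡ᵇ-refl : ∀ v → (v ≡ᵇ v) ≡ true
≡ᵇ-refl v = dec-true (v ≟ v) refl

≢⇒≡ᵇ≡false : ∀ {m n} → m ≢ n → (m ≡ᵇ n) ≡ false
≢⇒≡ᵇ≡false {m} {n} = dec-false (m ≟ n)

<⇒<ᵇ≡true : ∀ {m n} → m < n → (m <ᵇ n) ≡ true
<⇒<ᵇ≡true {m} {n} = dec-true (m <? n)

≥⇒<ᵇ≡false : ∀ {m n} → n ≤ m → (m <ᵇ n) ≡ false
≥⇒<ᵇ≡false {m} {n} = dec-false (m <? n) ∘ ≤⇒≯

<ᵇ-suc : ∀ m n → (m <ᵇ suc n) ≡ (m ≤ᵇ n)
<ᵇ-suc zero    n = refl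
<ᵇ-suc (suc m) n = refl

∸-suc : ∀ m n → m ∸ suc n ≡ pred m ∸ n
∸-suc zero    n = sym (0∸n≡0 n)
∸-suc (suc m) n = refl

Unique-++-∷⁻ : ∀ L {v : ℕ} {R} → Unique (L ++ v ∷ R) → All (v ≢_) L × All (v ≢_) R × Unique R
Unique-++-∷⁻ []      (v∉R ∷ uR) = [] , v∉R , uR
Unique-++-∷⁻ (x ∷ L) (x∉ ∷ u) with Unique-++-∷⁻ L u
... | v∉L , v∉R , uR = ≢-sym (All.lookup x∉ (++⁺ʳ L (here refl))) ∷ v∉L , v∉R , uR

<-after-maximum : ∀ L {v R} → Unique (L ++ v ∷ R) → All (_≤ v) (L ++ v ∷ R) → All (_< v) R
<-after-maximum L u ≤v =
  All.zipWith (λ (x≤v , v≢x) → ≤∧≢⇒< x≤v (≢-sym v≢x))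
              (All.tail (++⁻ʳ L ≤v) , proj₁ (proj₂ (Unique-++-∷⁻ L u)))

length-++-∷-≤ : ∀ L {v : ℕ} {R k} → length (L ++ v ∷ R) ≤ suc k → length L ≤ k × length R ≤ k
length-++-∷-≤ L {v} {R} |L++v∷R|≤ =
  ≤-trans (length-++-≤ˡ L) |L++R|≤ , ≤-trans (length-++-≤ʳ R {L}) |L++R|≤
  where |L++R|≤ = s≤s⁻¹ (subst (_≤ _) (length-++-sucʳ L v R) |L++v∷R|≤)

maxAtMost : ℕ → List ℕ → ℕ
maxAtMost t = foldr (λ m acc → if m ≤ᵇ t then m ⊔ acc else acc) 0

maxAtMost-≤ : ∀ t ms → maxAtMost t ms ≤ t
maxAtMost-≤ t []       = z≤n
maxAtMost-≤ t (m ∷ ms) with m ≤ᵇ t | ≤ᵇ⇒≤ m t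
... | true  | m≤t = ⊔-lub (m≤t _) (maxAtMost-≤ t ms)
... | false | _   = maxAtMost-≤ t ms

maxAtMost-∈ : ∀ {t ms} → t ∈ ms → maxAtMost t ms ≡ t
maxAtMost-∈ {t} {m ∷ ms} (here refl) with t ≤ᵇ t | ≤⇒≤ᵇ (≤-refl {t})
... | true | _ = m≥n⇒m⊔n≡m (maxAtMost-≤ t ms)
maxAtMost-∈ {t} {m ∷ ms} (there t∈ms) with m ≤ᵇ t | ≤ᵇ⇒≤ m t
... | true  | m≤t = trans (cong (m ⊔_) (maxAtMost-∈ t∈ms)) (m≤n⇒m⊔n≡n (m≤t _))
... | false | _   = maxAtMost-∈ t∈ms

maxL-∈ : ∀ x xs → maxL (x ∷ xs) ∈ x ∷ xs
maxL-∈ x []       = here (⊔-identityʳ x)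
maxL-∈ x (y ∷ ys) with ⊔-sel x (maxL (y ∷ ys))
... | inj₁ e = here e
... | inj₂ e = there (subst (_∈ y ∷ ys) (sym e) (maxL-∈ y ys))

≤-maxL : ∀ xs → All (_≤ maxL xs) xs
≤-maxL []       = []
≤-maxL (x ∷ xs) = m≤m⊔n x _ ∷ All.map (λ p → ≤-trans p (m≤n⊔m x (maxL xs))) (≤-maxL xs)

splitAt≡-∈ : ∀ m σ → m ∈ σ → σ ≡ proj₁ (splitAt≡ m σ) ++ m ∷ proj₂ (splitAt≡ m σ)
splitAt≡-∈ m (x ∷ xs) m∈ with x ≡ᵇ m in x≡ᵇm
... | true = cong (_∷ xs) (≡ᵇ⇒≡ x m (subst T (sym x≡ᵇm) _))
... | false with m∈
...   | here m≡x    = ⊥-elim (subst T x≡ᵇm (≡⇒≡ᵇ x m (sym m≡x)))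
...   | there m∈xs = cong (x ∷_) (splitAt≡-∈ m xs m∈xs)

splitAt≡-maxL : ∀ x xs → let m = maxL (x ∷ xs) in
                x ∷ xs ≡ proj₁ (splitAt≡ m (x ∷ xs)) ++ m ∷ proj₂ (splitAt≡ m (x ∷ xs))
splitAt≡-maxL x xs = splitAt≡-∈ (maxL (x ∷ xs)) (x ∷ xs) (maxL-∈ x xs)

rmaxs : List ℕ → List ℕ
rmaxs []       = []
rmaxs (x ∷ xs) = if allLess x xs then x ∷ rmaxs xs else rmaxs xs

rmax≡length-rmaxs : ∀ σ → rmax σ ≡ length (rmaxs σ)
rmax≡length-rmaxs []       = refl
rmax≡length-rmaxs (x ∷ xs) with allLess x xs
... | true  = cong suc (rmax≡length-rmaxs xs)
... | false = rmax≡length-rmaxs xs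

rmaxs-⊆ : ∀ σ → rmaxs σ ⊆ σ
rmaxs-⊆ []       = []
rmaxs-⊆ (x ∷ xs) with allLess x xs
... | true  = refl ∷ rmaxs-⊆ xs
... | false = x ∷ʳ rmaxs-⊆ xs

allLess-true : ∀ {x} ys → All (_< x) ys → allLess x ys ≡ true
allLess-true []       []         = refl
allLess-true (y ∷ ys) (y<x ∷ ys<x) rewrite <⇒<ᵇ≡true y<x = allLess-true ys ys<x

allLess-false : ∀ {x} ys → Any (x ≤_) ys → allLess x ys ≡ false
allLess-false {x} (y ∷ ys) (here x≤y)  rewrite ≥⇒<ᵇ≡false x≤y = refl
allLess-false {x} (y ∷ ys) (there x≤ys) rewrite allLess-false ys x≤ys = ∧-zeroʳ (y <ᵇ x)

rmaxs-++-∷ : ∀ L {v R} → All (_≤ v) L → All (_< v) R → rmaxs (L ++ v ∷ R) ≡ v ∷ rmaxs R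
rmaxs-++-∷ []      {v} {R} []           R<v rewrite allLess-true R R<v = refl
rmaxs-++-∷ (x ∷ L) {v} {R} (x≤v ∷ L≤v) R<v
  rewrite allLess-false (L ++ v ∷ R) (++⁺ʳ L (here x≤v)) = rmaxs-++-∷ L L≤v R<v

rmaxs-maximum : ∀ L {v R} → Unique (L ++ v ∷ R) → All (_≤ v) (L ++ v ∷ R) →
                rmaxs (L ++ v ∷ R) ≡ v ∷ rmaxs R
rmaxs-maximum L u ≤v = rmaxs-++-∷ L (++⁻ˡ L ≤v) (<-after-maximum L u ≤v)

stackSortF-↭ : ∀ k σ → length σ ≤ k → stackSortF k σ ↭ σ
stackSortF-↭ zero    []       _ = ↭-refl
stackSortF-↭ (suc k) []       _ = ↭-refl
stackSortF-↭ (suc k) (x ∷ xs) |σ|≤ with splitAt≡ (maxL (x ∷ xs)) (x ∷ xs) | splitAt≡-maxL x xs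
... | L , R | σ≡ =
  ↭-trans (++⁺ˡ (stackSortF k L) (↭-sym (∷↭∷ʳ m (stackSortF k R))))
          (↭-trans (++⁺ (stackSortF-↭ k L (proj₁ fuel)) (prep m (stackSortF-↭ k R (proj₂ fuel))))
                   (↭-reflexive (sym σ≡)))
  where
  m = maxL (x ∷ xs)
  fuel = length-++-∷-≤ L (subst (λ π → length π ≤ suc k) σ≡ |σ|≤)

reverse-stackSortF : ∀ k σ → length σ ≤ k → Unique σ →
                     ∃ λ Z → reverse (stackSortF k σ) ≡ rmaxs σ ++ Z
reverse-stackSortF zero    []       _ _ = [] , refl
reverse-stackSortF (suc k) []       _ _ = [] , refl
reverse-stackSortF (suc k) (x ∷ xs) |σ|≤ u with splitAt≡ (maxL (x ∷ xs)) (x ∷ xs) | splitAt≡-maxL x xs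
... | L , R | σ≡ = extend (reverse-stackSortF k R |R|≤k (proj₂ (proj₂ (Unique-++-∷⁻ L u′))))
  where
  m = maxL (x ∷ xs)
  u′ = subst Unique σ≡ u
  |R|≤k = proj₂ (length-++-∷-≤ L (subst (λ π → length π ≤ suc k) σ≡ |σ|≤))
  rmaxs≡ : rmaxs (x ∷ xs) ≡ m ∷ rmaxs R
  rmaxs≡ = trans (cong rmaxs σ≡) (rmaxs-maximum L u′ (subst (All (_≤ m)) σ≡ (≤-maxL (x ∷ xs))))
  sL = stackSortF k L
  sR = stackSortF k R
  extend : (∃ λ Z → reverse sR ≡ rmaxs R ++ Z) →
           ∃ λ Z → reverse (sL ++ sR ++ [ m ]) ≡ rmaxs (x ∷ xs) ++ Z
  extend (Z , reverse-sR≡) = Z ++ reverse sL , (begin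
      reverse (sL ++ sR ++ [ m ])       ≡⟨ reverse-++ sL (sR ++ [ m ]) ⟩
      reverse (sR ++ [ m ]) ++ reverse sL ≡⟨ cong (_++ reverse sL) (reverse-++ sR [ m ]) ⟩
      m ∷ reverse sR ++ reverse sL      ≡⟨ cong (λ ys → m ∷ ys ++ reverse sL) reverse-sR≡ ⟩
      m ∷ (rmaxs R ++ Z) ++ reverse sL  ≡⟨ cong (m ∷_) (++-assoc (rmaxs R) Z (reverse sL)) ⟩
      m ∷ rmaxs R ++ Z ++ reverse sL    ≡⟨ cong (_++ Z ++ reverse sL) (sym rmaxs≡) ⟩
      rmaxs (x ∷ xs) ++ Z ++ reverse sL ∎)

s-↭ : ∀ σ → s σ ↭ σ
s-↭ σ = stackSortF-↭ (length σ) σ ≤-refl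

reverse-s : ∀ σ → Unique σ → ∃ λ Z → reverse (s σ) ≡ rmaxs σ ++ Z
reverse-s σ = reverse-stackSortF (length σ) σ ≤-refl

countdownRun : ℕ → List ℕ → ℕ
countdownRun v []       = 0
countdownRun v (d ∷ ds) = if d ≡ᵇ v then suc (countdownRun (pred v) ds) else 0

countdownRun-∷ : ∀ v D → countdownRun v (v ∷ D) ≡ suc (countdownRun (pred v) D)
countdownRun-∷ v D rewrite ≡ᵇ-refl v = refl

countdownRun-≤-length : ∀ v D → countdownRun v D ≤ length D
countdownRun-≤-length v []       = z≤n
countdownRun-≤-length v (d ∷ ds) with d ≡ᵇ v
... | true  = s≤s (countdownRun-≤-length (pred v) ds)
... | false = z≤n

length⊓countdownRun-++ : ∀ v D Z → length D ⊓ countdownRun v (D ++ Z) ≡ countdownRun v D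
length⊓countdownRun-++ v []       Z = refl
length⊓countdownRun-++ v (d ∷ ds) Z with d ≡ᵇ v
... | true  = cong suc (length⊓countdownRun-++ (pred v) ds Z)
... | false = refl

entry-++-∷ : ∀ X (a : ℕ) B → entry (X ++ a ∷ B) (suc (length X)) ≡ just a
entry-++-∷ []          a B = refl
entry-++-∷ (x ∷ [])    a B = refl
entry-++-∷ (x ∷ y ∷ X) a B = entry-++-∷ (y ∷ X) a B

isFixed-ʳ++ : ∀ D a B → isFixed (D ʳ++ a ∷ B) (suc (length D)) ≡ (a ≡ᵇ suc (length D))
isFixed-ʳ++ D a B
  rewrite ʳ++-defn D {a ∷ B} | sym (length-reverse D) | entry-++-∷ (reverse D) a B = refl

-- Stated with ʳ++ because (a ∷ D) ʳ++ B reduces to D ʳ++ a ∷ B, which is the induction step.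
tlFrom-ʳ++ : ∀ D B ℓ →
             tlFrom (length D + ℓ) (D ʳ++ B) ℓ (length D) ≡ ℓ + countdownRun (length D) D
tlFrom-ʳ++ []      B ℓ = sym (+-identityʳ ℓ)
tlFrom-ʳ++ (a ∷ D) B ℓ = begin
    (if isFixed π (suc m + ℓ ∸ ℓ) then tlFrom (suc m + ℓ) π (suc ℓ) m else ℓ)
  ≡⟨ cong₂ (λ i n → if isFixed π i then tlFrom n π (suc ℓ) m else ℓ)
           (m+n∸n≡m (suc m) ℓ) (sym (+-suc m ℓ)) ⟩
    (if isFixed π (suc m) then tlFrom (m + suc ℓ) π (suc ℓ) m else ℓ)
  ≡⟨ cong₂ (λ b t → if b then t else ℓ) (isFixed-ʳ++ D a B) (tlFrom-ʳ++ D (a ∷ B) (suc ℓ)) ⟩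
    (if a ≡ᵇ suc m then suc ℓ + countdownRun m D else ℓ)
  ≡⟨ +-if (a ≡ᵇ suc m) ⟩
    ℓ + countdownRun (suc m) (a ∷ D)
  ∎
  where
  m = length D
  π = D ʳ++ a ∷ B
  +-if : ∀ b → (if b then suc ℓ + countdownRun m D else ℓ) ≡
               ℓ + (if b then suc (countdownRun m D) else 0)
  +-if true  = sym (+-suc ℓ _)
  +-if false = sym (+-identityʳ ℓ)

tl-reverse : ∀ D → tl (length D) (reverse D) ≡ countdownRun (length D) D
tl-reverse D = subst (λ n → tlFrom n (reverse D) 0 (length D) ≡ countdownRun (length D) D)
                     (+-identityʳ (length D)) (tlFrom-ʳ++ D [] 0)

tl≡countdownRun-reverse : ∀ {n} π → length π ≡ n → tl n π ≡ countdownRun n (reverse π)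
tl≡countdownRun-reverse {n} π |π|≡n = begin
  tl n π                           ≡⟨ cong₂ tl (sym |π̃|≡n) (sym (reverse-involutive π)) ⟩
  tl (length π̃) (reverse π̃)        ≡⟨ tl-reverse π̃ ⟩
  countdownRun (length π̃) π̃        ≡⟨ cong (λ k → countdownRun k π̃) |π̃|≡n ⟩
  countdownRun n π̃                 ∎
  where
  π̃ = reverse π
  |π̃|≡n = trans (length-reverse π) |π|≡n

topDown-suc : ∀ v j → topDown v (suc j) ≡ v ∷ topDown (pred v) j
topDown-suc v j = cong (v ∷_) (begin
  map (v ∸_) (applyUpTo suc j)          ≡⟨ cong (map (v ∸_)) (sym (map-upTo suc j)) ⟩
  map (v ∸_) (map suc (upTo j))         ≡⟨ map-∘ (upTo j) ⟨
  map (λ i → v ∸ suc i) (upTo j)        ≡⟨ map-cong (∸-suc v) (upTo j) ⟩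
  map (pred v ∸_) (upTo j)              ∎)

isSubseq-++-∷ : ∀ {v} T L R → All (v ≢_) L → isSubseq (v ∷ T) (L ++ v ∷ R) ≡ isSubseq T R
isSubseq-++-∷ {v} T []      R []            rewrite ≡ᵇ-refl v = refl
isSubseq-++-∷     T (x ∷ L) R (v≢x ∷ v∉L) rewrite ≢⇒≡ᵇ≡false v≢x = isSubseq-++-∷ T L R v∉L

isSubseq-∉ : ∀ {v} T σ → All (v ≢_) σ → isSubseq (v ∷ T) σ ≡ false
isSubseq-∉ T []      []            = refl
isSubseq-∉ T (x ∷ σ) (v≢x ∷ v∉σ) rewrite ≢⇒≡ᵇ≡false v≢x = isSubseq-∉ T σ v∉σ

countdownRun-∉ : ∀ {v} D → All (v ≢_) D → countdownRun v D ≡ 0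
countdownRun-∉ []      []        = refl
countdownRun-∉ (d ∷ D) (v≢d ∷ _) rewrite ≢⇒≡ᵇ≡false (≢-sym v≢d) = refl

isSubseq-topDown : ∀ j v σ → Unique σ → All (_≤ v) σ →
                   isSubseq (topDown v j) σ ≡ (j ≤ᵇ countdownRun v (rmaxs σ))
isSubseq-topDown zero    v σ u σ≤v = refl
isSubseq-topDown (suc j) v σ u σ≤v rewrite topDown-suc v j with v ∈? σ
... | no v∉σ = begin
    isSubseq (v ∷ topDown (pred v) j) σ      ≡⟨ isSubseq-∉ _ σ (¬Any⇒All¬ σ v∉σ) ⟩
    false                                   ≡⟨ cong (suc j ≤ᵇ_) (countdownRun-∉ (rmaxs σ) v∉rmaxs) ⟨
    suc j ≤ᵇ countdownRun v (rmaxs σ)       ∎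
  where v∉rmaxs = All-resp-⊆ (rmaxs-⊆ σ) (¬Any⇒All¬ σ v∉σ)
... | yes v∈σ with ∈-∃++ v∈σ
...   | L , R , refl = begin
    isSubseq (v ∷ topDown (pred v) j) (L ++ v ∷ R)   ≡⟨ isSubseq-++-∷ _ L R v∉L ⟩
    isSubseq (topDown (pred v) j) R                  ≡⟨ isSubseq-topDown j (pred v) R uR R≤pred-v ⟩
    j ≤ᵇ countdownRun (pred v) (rmaxs R)             ≡⟨ <ᵇ-suc j _ ⟨
    suc j ≤ᵇ suc (countdownRun (pred v) (rmaxs R))   ≡⟨ cong (suc j ≤ᵇ_) (countdownRun-∷ v (rmaxs R)) ⟨
    suc j ≤ᵇ countdownRun v (v ∷ rmaxs R)
      ≡⟨ cong (λ D → suc j ≤ᵇ countdownRun v D) (rmaxs-maximum L u σ≤v) ⟨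
    suc j ≤ᵇ countdownRun v (rmaxs (L ++ v ∷ R))     ∎
  where
  v∉L = proj₁ (Unique-++-∷⁻ L u)
  uR = proj₂ (proj₂ (Unique-++-∷⁻ L u))
  R≤pred-v = All.map pred-mono-≤ (<-after-maximum L u σ≤v)

zeil≡countdownRun-rmaxs : ∀ n σ → Unique σ → All (_≤ n) σ → length σ ≤ n →
                          zeil n σ ≡ countdownRun n (rmaxs σ)
zeil≡countdownRun-rmaxs n σ u σ≤n |σ|≤n = begin
    zeil n σ                     ≡⟨ foldr-cong step refl (upTo (suc n)) ⟩
    maxAtMost t (upTo (suc n))   ≡⟨ maxAtMost-∈ (∈-upTo⁺ (s≤s t≤n)) ⟩
    t                            ∎
  where
  t = countdownRun n (rmaxs σ)
  t≤n = ≤-trans (countdownRun-≤-length n (rmaxs σ)) (≤-trans (length-mono-≤ (rmaxs-⊆ σ)) |σ|≤n)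
  step : ∀ m acc → (if isSubseq (topDown n m) σ then m ⊔ acc else acc) ≡
                   (if m ≤ᵇ t then m ⊔ acc else acc)
  step m acc = cong (λ b → if b then m ⊔ acc else acc) (isSubseq-topDown m n σ u σ≤n)

IsPerm-length : ∀ {n σ} → IsPerm n σ → length σ ≡ n
IsPerm-length {n} σ↭ = trans (↭-length σ↭) (trans (length-map suc (upTo n)) (length-upTo n))

IsPerm-unique : ∀ {n σ} → IsPerm n σ → Unique σ
IsPerm-unique {n} σ↭ = Unique-resp-↭ (↭⇒↭ₛ (↭-sym σ↭)) (Unique.map⁺ suc-injective (Unique.upTo⁺ n))

IsPerm-≤ : ∀ {n σ} → IsPerm n σ → All (_≤ n) σ
IsPerm-≤ σ↭ = All-resp-↭ (↭-sym σ↭) (AllP.map⁺ (All.tabulate ∈-upTo⁻))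

lemma3p2 : (n : ℕ) (σ : List ℕ) → IsPerm n σ → zeil n σ ≡ rmax σ ⊓ tl n (s σ)
lemma3p2 n σ σ↭ with reverse-s σ (IsPerm-unique σ↭)
... | Z , reverse-s≡ = begin
    zeil n σ
  ≡⟨ zeil≡countdownRun-rmaxs n σ u (IsPerm-≤ σ↭) (≤-reflexive |σ|≡n) ⟩
    countdownRun n D
  ≡⟨ length⊓countdownRun-++ n D Z ⟨
    length D ⊓ countdownRun n (D ++ Z)
  ≡⟨ cong (λ π → length D ⊓ countdownRun n π) reverse-s≡ ⟨
    length D ⊓ countdownRun n (reverse (s σ))
  ≡⟨ cong₂ _⊓_ (rmax≡length-rmaxs σ) (tl≡countdownRun-reverse (s σ) |sσ|≡n) ⟨
    rmax σ ⊓ tl n (s σ)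
  ∎
  where
  u = IsPerm-unique σ↭
  D = rmaxs σ
  |σ|≡n = IsPerm-length σ↭
  |sσ|≡n = trans (↭-length (s-↭ σ)) |σ|≡n
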